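{- Let $G=(V,E)$ be an undirected graph, $\ell\in\mathbb{N}$, $\omega\colon E\to\mathbb{Z}$, and let $G'$, $E'_1$, $\pi$, and the extended $\omega$ be as in the context. For $w\in\mathbb{Z}$ let $\mathcal{C}_w=\{(F,(L,R)) : F\subseteq E \text{ is a partial cycle cover},\ |F|=\ell,\ \omega(F)=w,\ (L,R)\text{ a cut of } V\text{ consistent with } F\}$ and $\mathcal{M}_w=\{(M,(L,R)) : M\text{ is a simple perfect matching in } G',\ \omega(M)=w,\ |M\cap E'_1|=\ell,\ (L,R)\text{ a cut of } V\text{ consistent with }\pi(M)\}$. Then for every $w\in\mathbb{Z}$, $|\mathcal{M}_w|=2^{\ell}\cdot|\mathcal{C}_w|$.
   Context: $G'$ has vertex set $V'=\{u^0,u^1:u\in V\}$ and edge set $E'=E'_0\cup E'_1$ with $E'_0=\{u^0u^1:u\in V\}$ and $E'_1=\{u^0v^0,u^0v^1,u^1v^0,u^1v^1: uv\in E\}$. $\pi\colon E'_1\to E$ maps $u^sv^t\mapsto uv$, and $\pi(F)=\{\pi(e):e\in F\cap E'_1\}$ for $F\subseteq E'$. $F\subseteq E'$ is simple if $|F\cap \pi^{ -1}(e)|\le 1$ for all $e\in E$. $\omega$ is extended to $E'$ by $\omega(e)=0$ for $e\in E'_0$ and $\omega(e)=\omega(\pi(e))$ for $e\in E'_1$; $\omega(F)=\sum_{e\in F}\omega(e)$. A partial cycle cover is $F\subseteq E$ with every vertex incident to $0$ or $2$ edges of $F$. A cut of $V$ is an ordered pair $(L,R)$ with $L\cap R=\emptyset$,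 $L\cup R=V$; it is consistent with $F\subseteq E$ if no edge of $F$ joins $L$ and $R$. -}

module Defs where

open import Data.Nat as ℕ using (ℕ; zero; suc; _≤_)
import Data.Nat.Properties as ℕP
open import Data.Integer as ℤ using (ℤ; +_)
open import Data.Bool using (Bool; true; false; if_then_else_)
open import Data.Fin using (Fin; _≟_)
open import Data.Fin.Subset using (Subset; _∈_; ∁)
open import Data.Fin.Subset.Properties using (_∈?_)
open import Data.Fin.Properties using (all?; any?)
open import Data.Vec as V using (Vec; lookup; tabulate)
open import Data.List as L using (List; []; _∷_; allFin; cartesianProduct; filter; length)
open import Data.Product using (Σ; ∃; ∃₂; _×_; _,_; proj₁; proj₂; swap)
open import Data.Product.Properties using (≡-dec)
open import Data.Sum using (_⊎_; inj₁; inj₂)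
open import Relation.Binary.PropositionalEquality using (_≡_; _≢_)
open import Relation.Nullary using (Dec; ¬_)
open import Relation.Nullary.Decidable using (map′; _×-dec_; _⊎-dec_; _→-dec_)
open import Relation.Unary using (Decidable)

record Graph : Set where
  field
    n : ℕ
    m : ℕ
    ends     : Fin m → Fin n × Fin n
    loopless : ∀ e → proj₁ (ends e) ≢ proj₂ (ends e)
    simple   : ∀ e f → (ends e ≡ ends f ⊎ ends e ≡ swap (ends f)) → e ≡ f

vecsOver : {A : Set} → List A → (k : ℕ) → List (Vec A k)
vecsOver xs zero    = V.[] ∷ []
vecsOver xs (suc k) = L.map (λ p → proj₁ p V.∷ proj₂ p) (cartesianProduct xs (vecsOver xs k))

subsets : (k : ℕ) → List (Subset k)
subsets = vecsOver (true ∷ false ∷ [])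

count : {A : Set} {P : A → Set} → Decidable P → List A → ℕ
count P? xs = length (filter P? xs)

sumℤ : List ℤ → ℤ
sumℤ = L.foldr ℤ._+_ (+ 0)

module _ (G : Graph) where
  open Graph G

  Incident : Fin n → Fin m → Set
  Incident v e = v ≡ proj₁ (ends e) ⊎ v ≡ proj₂ (ends e)

  incident? : ∀ v e → Dec (Incident v e)
  incident? v e = (v ≟ proj₁ (ends e)) ⊎-dec (v ≟ proj₂ (ends e))

  deg : Subset m → Fin n → ℕ
  deg F v = count (λ e → (e ∈? F) ×-dec incident? v e) (allFin m)

  size : Subset m → ℕ
  size F = count (λ e → e ∈? F) (allFin m)

  weight : (Fin m → ℤ) → Subset m → ℤ
  weight ω F = sumℤ (L.map (λ e → if lookup F e then ω e else + 0) (allFin m))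

  IsPartialCycleCover : Subset m → Set
  IsPartialCycleCover F = ∀ v → deg F v ≡ 0 ⊎ deg F v ≡ 2

  -- A cut (L , R) of V is encoded by L : Subset n, with R = ∁ L
  -- (this is a bijection between ordered partitions (L,R) and subsets L).
  Cut : Set
  Cut = Subset n

  Consistent : Cut → Subset m → Set
  Consistent L F = ∀ e → e ∈ F →
    ¬ ((proj₁ (ends e) ∈ L × proj₂ (ends e) ∈ ∁ L) ⊎ (proj₁ (ends e) ∈ ∁ L × proj₂ (ends e) ∈ L))

  -- The graph G'.  Vertices: V' = Fin n × Fin 2, (u , s) stands for u^s.
  V' : Set
  V' = Fin n × Fin 2

  -- Edge indices: inj₁ u is u^0 u^1 ∈ E'_0;
  -- inj₂ (e , s , t) is u^s v^t ∈ E'_1 where ends e = (u , v).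
  E' : Set
  E' = Fin n ⊎ (Fin m × Fin 2 × Fin 2)

  ends' : E' → V' × V'
  ends' (inj₁ u)           = (u , Fin.zero) , (u , Fin.suc Fin.zero)
  ends' (inj₂ (e , s , t)) = (proj₁ (ends e) , s) , (proj₂ (ends e) , t)

  allE' : List E'
  allE' = L.map inj₁ (allFin n) L.++
          L.map inj₂ (cartesianProduct (allFin m) (cartesianProduct (allFin 2) (allFin 2)))

  -- A subset of E': its E'_0 part and its E'_1 part
  -- (M1 [e][s][t] = true iff u^s v^t ∈ M, for ends e = (u , v)).
  Sub' : Set
  Sub' = Subset n × Vec (Vec (Subset 2) 2) m

  _∈'_ : E' → Sub' → Set
  inj₁ u           ∈' M = u ∈ proj₁ M
  inj₂ (e , s , t) ∈' M = t ∈ lookup (lookup (proj₂ M) e) s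

  _∈'?_ : ∀ x M → Dec (x ∈' M)
  inj₁ u           ∈'? M = u ∈? proj₁ M
  inj₂ (e , s , t) ∈'? M = t ∈? lookup (lookup (proj₂ M) e) s

  Incident' : V' → E' → Set
  Incident' x f = x ≡ proj₁ (ends' f) ⊎ x ≡ proj₂ (ends' f)

  incident'? : ∀ x f → Dec (Incident' x f)
  incident'? x f = ≡-dec _≟_ _≟_ x (proj₁ (ends' f)) ⊎-dec ≡-dec _≟_ _≟_ x (proj₂ (ends' f))

  deg' : Sub' → V' → ℕ
  deg' M x = count (λ f → (f ∈'? M) ×-dec incident'? x f) allE'

  IsPerfectMatching : Sub' → Set
  IsPerfectMatching M = ∀ x → deg' M x ≡ 1

  fibre : Sub' → Fin m → ℕ
  fibre M e = count (λ st → inj₂ (e , proj₁ st , proj₂ st) ∈'? M)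
                    (cartesianProduct (allFin 2) (allFin 2))

  IsSimple : Sub' → Set
  IsSimple M = ∀ e → fibre M e ≤ 1

  π : Sub' → Subset m
  π M = tabulate (λ e → Dec.does (any? (λ s → any? (λ t → inj₂ (e , s , t) ∈'? M))))

  size₁ : Sub' → ℕ
  size₁ M = count (λ f → f ∈'? M) (L.map inj₂ (cartesianProduct (allFin m) (cartesianProduct (allFin 2) (allFin 2))))

  ω' : (Fin m → ℤ) → E' → ℤ
  ω' ω (inj₁ u)           = + 0
  ω' ω (inj₂ (e , s , t)) = ω e

  weight' : (Fin m → ℤ) → Sub' → ℤ
  weight' ω M = sumℤ (L.map (λ f → if Dec.does (f ∈'? M) then ω' ω f else + 0) allE')

  allSub' : List Sub'
  allSub' = cartesianProduct (subsets n) (vecsOver (vecsOver (subsets 2) 2) m)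

  InC : ℕ → (Fin m → ℤ) → ℤ → Subset m × Cut → Set
  InC ℓ ω w (F , L) = IsPartialCycleCover F × size F ≡ ℓ × weight ω F ≡ w × Consistent L F

  InM : ℕ → (Fin m → ℤ) → ℤ → Sub' × Cut → Set
  InM ℓ ω w (M , L) = (IsSimple M × IsPerfectMatching M) × weight' ω M ≡ w × size₁ M ≡ ℓ
                      × Consistent L (π M)

  private
    consistent? : ∀ L F → Dec (Consistent L F)
    consistent? L F = all? λ e → (e ∈? F) →-dec
      (Relation.Nullary.¬? (((proj₁ (ends e) ∈? L) ×-dec (proj₂ (ends e) ∈? ∁ L))
                ⊎-dec ((proj₁ (ends e) ∈? ∁ L) ×-dec (proj₂ (ends e) ∈? L))))

  InC? : ∀ ℓ ω w → Decidable (InC ℓ ω w)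
  InC? ℓ ω w (F , L) =
    (all? (λ v → (deg F v ℕ.≟ 0) ⊎-dec (deg F v ℕ.≟ 2))) ×-dec (size F ℕ.≟ ℓ)
    ×-dec (weight ω F ℤ.≟ w) ×-dec consistent? L F

  InM? : ∀ ℓ ω w → Decidable (InM ℓ ω w)
  InM? ℓ ω w (M , L) =
    ((all? (λ e → fibre M e ℕP.≤? 1)) ×-dec
     (map′ (λ h x → h (proj₁ x) (proj₂ x)) (λ h u s → h (u , s))
       (all? (λ u → all? (λ s → deg' M (u , s) ℕ.≟ 1)))))
    ×-dec (weight' ω M ℤ.≟ w) ×-dec (size₁ M ℕ.≟ ℓ) ×-dec consistent? L (π M)

  #C : ℕ → (Fin m → ℤ) → ℤ → ℕ
  #C ℓ ω w = count (InC? ℓ ω w) (cartesianProduct (subsets m) (subsets n))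

  #M : ℕ → (Fin m → ℤ) → ℤ → ℕ
  #M ℓ ω w = count (InM? ℓ ω w) (cartesianProduct allSub' (subsets n))

module Submission where

-- Proof: an explicit bijection between ℳ_w and the triples ((F , L) , c) with
-- (F , L) ∈ 𝒞_w and c ⊆ V₂(F), the set of vertices of degree 2 in F.
--  * A simple M is determined by the edges of π(M) and, for each of them, the copies
--    of its two ends that it uses (SingleBlocks).  Then size and weight of M are those
--    of π(M), and the degree of u^s in G' is [u⁰u¹ ∈ M] plus the number of edges of
--    π(M) at u that use the copy u^s.
--  * Hence M is perfect iff at every u either u⁰u¹ ∈ M and u is isolated in π(M), or
--    u has degree 2 in π(M) and its two edges use different copies of u.  Recording
--    the copy c(u) used by the first (smallest) edge at u gives the map to triples;
--    conversely (F , c) yields the matching in which the first edge at u uses u^{c(u)}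
--    and the second edge the other copy.
--  * By the handshake lemma a partial cycle cover with ℓ edges has ℓ vertices of
--    degree 2, so each (F , L) ∈ 𝒞_w extends to exactly 2^ℓ triples.

open import Defs
open import Data.Nat as ℕ using (ℕ; zero; suc; _+_; _*_; _^_; _≤_)
import Data.Nat.Properties as ℕP
open import Data.Nat.Tactic.RingSolver using (solve-∀)
open import Data.Bool as Bool using (Bool; true; false; not; if_then_else_)
open import Data.Fin as F using (Fin; _≟_)
import Data.Fin.Properties as FP
open import Data.Fin.Subset using (Subset)
open import Data.Fin.Subset.Properties using (_∈?_)
open import Data.List as L using (List; []; _∷_; _++_; map; cartesianProduct; allFin)
open import Data.Vec as V using (Vec; lookup; tabulate)
import Data.Vec.Properties as VP
open import Data.Integer as ℤ using (ℤ) renaming (+_ to pos)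
import Data.Integer.Properties as ℤP
open import Data.Product using (Σ; ∃; _×_; _,_; proj₁; proj₂)
import Data.Product.Properties as PP
open import Data.Sum using (_⊎_; inj₁; inj₂) renaming (map to ⊎-map)
open import Data.Empty using (⊥-elim)
open import Relation.Binary.PropositionalEquality
open import Relation.Binary.Definitions using (DecidableEquality)
open import Relation.Nullary using (Dec; yes; no; ¬_; does)
open import Relation.Nullary.Decidable using (_×-dec_; _⊎-dec_; _→-dec_; ¬?; map′; dec-true; dec-false; does-≡)
open import Relation.Unary using (Decidable)
open import Function using (_∘_)

private variable
  A B : Set
  P Q : Set

-- Decisions as 0/1 numbers, so that counting becomes summation.

bit : Bool → ℕ
bit true  = 1
bit false = 0

χ : Dec P → ℕ
χ d = bit (does d)

bit≤1 : ∀ b → bit b ≤ 1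
bit≤1 true  = ℕ.s≤s ℕ.z≤n
bit≤1 false = ℕ.z≤n

does-true : (d : Dec P) → does d ≡ true → P
does-true (yes p) _ = p

does-⇔ : (d : Dec P) (e : Dec Q) → (P → Q) → (Q → P) → does d ≡ does e
does-⇔ d e to from = does-≡ (map′ to from d) e

χ-⇔ : (d : Dec P) (e : Dec Q) → (P → Q) → (Q → P) → χ d ≡ χ e
χ-⇔ d e to from = cong bit (does-⇔ d e to from)

χ-yes : (d : Dec P) → P → χ d ≡ 1
χ-yes d p = cong bit (dec-true d p)

χ-no : (d : Dec P) → ¬ P → χ d ≡ 0
χ-no d ¬p = cong bit (dec-false d ¬p)

χ-× : (d : Dec P) (e : Dec Q) → χ (d ×-dec e) ≡ χ d * χ e
χ-× (yes _) (yes _) = refl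
χ-× (yes _) (no _)  = refl
χ-× (no _)  e       = refl

χ-⊎ : (d : Dec P) (e : Dec Q) → ¬ (P × Q) → χ (d ⊎-dec e) ≡ χ d + χ e
χ-⊎ (yes p) (yes q) excl = ⊥-elim (excl (p , q))
χ-⊎ (yes _) (no _)  _    = refl
χ-⊎ (no _)  (yes _) _    = refl
χ-⊎ (no _)  (no _)  _    = refl

χ-∈ : ∀ {k} (x : Fin k) (p : Subset k) → χ (x ∈? p) ≡ bit (lookup p x)
χ-∈ F.zero    (true V.∷ p)  = refl
χ-∈ F.zero    (false V.∷ p) = refl
χ-∈ (F.suc x) (_ V.∷ p)     = χ-∈ x p

χ-true : ∀ b → χ (b Bool.≟ true) ≡ bit b
χ-true true  = refl
χ-true false = refl

∑ : List A → (A → ℕ) → ℕ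
∑ []       f = 0
∑ (x ∷ xs) f = f x + ∑ xs f

count-as-∑ : {P : A → Set} (P? : Decidable P) (xs : List A) → count P? xs ≡ ∑ xs (λ x → χ (P? x))
count-as-∑ P? [] = refl
count-as-∑ P? (x ∷ xs) with P? x
... | yes _ = cong suc (count-as-∑ P? xs)
... | no _  = count-as-∑ P? xs

∑-cong : ∀ (xs : List A) {f g : A → ℕ} → (∀ x → f x ≡ g x) → ∑ xs f ≡ ∑ xs g
∑-cong []       h = refl
∑-cong (x ∷ xs) h = cong₂ _+_ (h x) (∑-cong xs h)

∑-zero : ∀ (xs : List A) → ∑ xs (λ _ → 0) ≡ 0
∑-zero []       = refl
∑-zero (x ∷ xs) = ∑-zero xs

∑-++ : ∀ (xs ys : List A) (f : A → ℕ) → ∑ (xs ++ ys) f ≡ ∑ xs f + ∑ ys f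
∑-++ []       ys f = refl
∑-++ (x ∷ xs) ys f = trans (cong (f x +_) (∑-++ xs ys f)) (sym (ℕP.+-assoc (f x) _ _))

∑-map : ∀ (g : A → B) xs (f : B → ℕ) → ∑ (map g xs) f ≡ ∑ xs (λ x → f (g x))
∑-map g []       f = refl
∑-map g (x ∷ xs) f = cong (f (g x) +_) (∑-map g xs f)

∑-+ : ∀ (xs : List A) (f g : A → ℕ) → ∑ xs (λ x → f x + g x) ≡ ∑ xs f + ∑ xs g
∑-+ []       f g = refl
∑-+ (x ∷ xs) f g = trans (cong (f x + g x +_) (∑-+ xs f g)) (interchange (f x) (g x) _ _)
  where
  interchange : ∀ a b c d → (a + b) + (c + d) ≡ (a + c) + (b + d)
  interchange = solve-∀

∑-*ˡ : ∀ (xs : List A) k (f : A → ℕ) → ∑ xs (λ x → k * f x) ≡ k * ∑ xs f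
∑-*ˡ []       k f = sym (ℕP.*-zeroʳ k)
∑-*ˡ (x ∷ xs) k f = trans (cong (k * f x +_) (∑-*ˡ xs k f)) (sym (ℕP.*-distribˡ-+ k (f x) _))

∑-*ʳ : ∀ (xs : List A) k (f : A → ℕ) → ∑ xs (λ x → f x * k) ≡ ∑ xs f * k
∑-*ʳ xs k f = trans (∑-cong xs (λ x → ℕP.*-comm (f x) k)) (trans (∑-*ˡ xs k f) (ℕP.*-comm k _))

∑-swap : ∀ (xs : List A) (ys : List B) (f : A → B → ℕ) →
  ∑ xs (λ x → ∑ ys (λ y → f x y)) ≡ ∑ ys (λ y → ∑ xs (λ x → f x y))
∑-swap []       ys f = sym (∑-zero ys)
∑-swap (x ∷ xs) ys f =
  trans (cong (∑ ys (f x) +_) (∑-swap xs ys f)) (sym (∑-+ ys (f x) (λ y → ∑ xs (λ x' → f x' y))))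

∑-cartesian : ∀ (xs : List A) (ys : List B) (f : A × B → ℕ) →
  ∑ (cartesianProduct xs ys) f ≡ ∑ xs (λ x → ∑ ys (λ y → f (x , y)))
∑-cartesian []       ys f = refl
∑-cartesian (x ∷ xs) ys f =
  trans (∑-++ (map (x ,_) ys) _ f) (cong₂ _+_ (∑-map (x ,_) ys f) (∑-cartesian xs ys f))

∑-tabulate : ∀ {n} (g : Fin n → A) (f : A → ℕ) → ∑ (L.tabulate g) f ≡ ∑ (allFin n) (λ i → f (g i))
∑-tabulate {n = zero}  g f = refl
∑-tabulate {n = suc n} g f =
  cong (f (g F.zero) +_) (trans (∑-tabulate (g ∘ F.suc) f) (sym (∑-tabulate F.suc (f ∘ g))))

∑-allFin-suc : ∀ {n} (f : Fin (suc n) → ℕ) → ∑ (allFin (suc n)) f ≡ f F.zero + ∑ (allFin n) (λ i → f (F.suc i))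
∑-allFin-suc f = cong (f F.zero +_) (∑-tabulate F.suc f)

vec-ext : ∀ {k} (v w : Vec A k) → (∀ i → lookup v i ≡ lookup w i) → v ≡ w
vec-ext v w h = trans (sym (VP.tabulate∘lookup v)) (trans (VP.tabulate-cong h) (VP.tabulate∘lookup w))

Enumerates : DecidableEquality A → List A → Set
Enumerates {A} _≟ᴬ_ xs = ∀ (a : A) → ∑ xs (λ x → χ (x ≟ᴬ a)) ≡ 1

∑-point : (_≟ᴬ_ : DecidableEquality A) (xs : List A) → Enumerates _≟ᴬ_ xs →
  ∀ a (h : A → ℕ) → ∑ xs (λ x → χ (x ≟ᴬ a) * h x) ≡ h a
∑-point _≟ᴬ_ xs enum a h = begin
    ∑ xs (λ x → χ (x ≟ᴬ a) * h x) ≡⟨ ∑-cong xs move ⟩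
    ∑ xs (λ x → χ (x ≟ᴬ a) * h a) ≡⟨ ∑-*ʳ xs (h a) (λ x → χ (x ≟ᴬ a)) ⟩
    ∑ xs (λ x → χ (x ≟ᴬ a)) * h a ≡⟨ cong (_* h a) (enum a) ⟩
    1 * h a                       ≡⟨ ℕP.*-identityˡ (h a) ⟩
    h a                           ∎
  where
  open ≡-Reasoning
  move : ∀ x → χ (x ≟ᴬ a) * h x ≡ χ (x ≟ᴬ a) * h a
  move x with x ≟ᴬ a
  ... | yes refl = refl
  ... | no _     = refl

allFin-enumerates : ∀ n → Enumerates _≟_ (allFin n)
allFin-enumerates (suc n) F.zero =
  trans (∑-allFin-suc {n} (λ x → χ (x ≟ F.zero))) (cong suc (∑-zero (allFin n)))
allFin-enumerates (suc n) (F.suc a) =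
  trans (∑-allFin-suc {n} (λ x → χ (x ≟ F.suc a))) (allFin-enumerates n a)

cartesian-enumerates : (_≟ᴬ_ : DecidableEquality A) (_≟ᴮ_ : DecidableEquality B) (xs : List A) (ys : List B) →
  Enumerates _≟ᴬ_ xs → Enumerates _≟ᴮ_ ys → Enumerates (PP.≡-dec _≟ᴬ_ _≟ᴮ_) (cartesianProduct xs ys)
cartesian-enumerates _≟ᴬ_ _≟ᴮ_ xs ys enumˣ enumʸ (a , b) =
  trans (∑-cartesian xs ys _) (trans (∑-cong xs row) (enumˣ a))
  where
  pair : ∀ x y → χ (PP.≡-dec _≟ᴬ_ _≟ᴮ_ (x , y) (a , b)) ≡ χ (x ≟ᴬ a) * χ (y ≟ᴮ b)
  pair x y = trans (χ-⇔ (PP.≡-dec _≟ᴬ_ _≟ᴮ_ (x , y) (a , b)) (x ≟ᴬ a ×-dec y ≟ᴮ b)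
                        (λ { refl → refl , refl }) (λ { (refl , refl) → refl }))
                   (χ-× (x ≟ᴬ a) (y ≟ᴮ b))
  row : ∀ x → ∑ ys (λ y → χ (PP.≡-dec _≟ᴬ_ _≟ᴮ_ (x , y) (a , b))) ≡ χ (x ≟ᴬ a)
  row x = trans (∑-cong ys (pair x)) (trans (∑-*ˡ ys (χ (x ≟ᴬ a)) _)
            (trans (cong (χ (x ≟ᴬ a) *_) (enumʸ b)) (ℕP.*-identityʳ _)))

vecsOver-enumerates : (_≟ᴬ_ : DecidableEquality A) (xs : List A) → Enumerates _≟ᴬ_ xs →
  ∀ k → Enumerates (VP.≡-dec {n = k} _≟ᴬ_) (vecsOver xs k)
vecsOver-enumerates _≟ᴬ_ xs enum zero V.[] = refl
vecsOver-enumerates _≟ᴬ_ xs enum (suc k) (a V.∷ as) =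
  trans (∑-map _ (cartesianProduct xs (vecsOver xs k)) _)
    (trans (∑-cong (cartesianProduct xs (vecsOver xs k)) cons)
      (cartesian-enumerates _≟ᴬ_ (VP.≡-dec _≟ᴬ_) xs (vecsOver xs k) enum
        (vecsOver-enumerates _≟ᴬ_ xs enum k) (a , as)))
  where
  cons : ∀ p → χ (VP.≡-dec _≟ᴬ_ (proj₁ p V.∷ proj₂ p) (a V.∷ as)) ≡ χ (PP.≡-dec _≟ᴬ_ (VP.≡-dec _≟ᴬ_) p (a , as))
  cons (x , v) = χ-⇔ (VP.≡-dec _≟ᴬ_ (x V.∷ v) (a V.∷ as)) (PP.≡-dec _≟ᴬ_ (VP.≡-dec _≟ᴬ_) (x , v) (a , as))
                     (λ { refl → refl }) (λ { refl → refl })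

subsets-enumerate : ∀ k → Enumerates (VP.≡-dec Bool._≟_) (subsets k)
subsets-enumerate = vecsOver-enumerates Bool._≟_ (true ∷ false ∷ []) λ { true → refl ; false → refl }

-- Counting by a bijection: if f and g are mutually inverse between the elements
-- satisfying P in an enumeration xs and those satisfying Q in an enumeration ys,
-- then both counts agree.  (Each x with P x is matched to the unique y = f x.)
count-bijection : (_≟ᴬ_ : DecidableEquality A) (_≟ᴮ_ : DecidableEquality B) {xs : List A} {ys : List B} →
  Enumerates _≟ᴬ_ xs → Enumerates _≟ᴮ_ ys →
  {P : A → Set} {Q : B → Set} (P? : Decidable P) (Q? : Decidable Q)
  (f : A → B) (g : B → A) → (∀ x → P x → Q (f x)) → (∀ y → Q y → P (g y)) →
  (∀ x → P x → g (f x) ≡ x) → (∀ y → Q y → f (g y) ≡ y) →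
  count P? xs ≡ count Q? ys
count-bijection _≟ᴬ_ _≟ᴮ_ {xs} {ys} enumˣ enumʸ {P} {Q} P? Q? f g P⇒Q Q⇒P gf fg = begin
    count P? xs                                          ≡⟨ count-as-∑ P? xs ⟩
    ∑ xs (λ x → χ (P? x))                                ≡⟨ ∑-cong xs spread ⟩
    ∑ xs (λ x → ∑ ys (λ y → χ (P? x) * χ (f x ≟ᴮ y)))     ≡⟨ ∑-swap xs ys _ ⟩
    ∑ ys (λ y → ∑ xs (λ x → χ (P? x) * χ (f x ≟ᴮ y)))     ≡⟨ ∑-cong ys gather ⟩
    ∑ ys (λ y → χ (Q? y))                                ≡⟨ count-as-∑ Q? ys ⟨
    count Q? ys                                          ∎
  where
  open ≡-Reasoning
  -- every x contributes to exactly one y, namely f x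
  spread : ∀ x → χ (P? x) ≡ ∑ ys (λ y → χ (P? x) * χ (f x ≟ᴮ y))
  spread x = sym (begin
      ∑ ys (λ y → χ (P? x) * χ (f x ≟ᴮ y)) ≡⟨ ∑-*ˡ ys (χ (P? x)) _ ⟩
      χ (P? x) * ∑ ys (λ y → χ (f x ≟ᴮ y)) ≡⟨ cong (χ (P? x) *_) (∑-cong ys (λ y → χ-⇔ (f x ≟ᴮ y) (y ≟ᴮ f x) sym sym)) ⟩
      χ (P? x) * ∑ ys (λ y → χ (y ≟ᴮ f x)) ≡⟨ cong (χ (P? x) *_) (enumʸ (f x)) ⟩
      χ (P? x) * 1                         ≡⟨ ℕP.*-identityʳ _ ⟩
      χ (P? x)                             ∎)
  -- y receives one contribution (from g y) if Q y holds, and none otherwise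
  gather : ∀ y → ∑ xs (λ x → χ (P? x) * χ (f x ≟ᴮ y)) ≡ χ (Q? y)
  gather y with Q? y
  ... | yes q = trans (∑-cong xs (λ x → trans (sym (χ-× (P? x) (f x ≟ᴮ y)))
                  (χ-⇔ (P? x ×-dec f x ≟ᴮ y) (x ≟ᴬ g y)
                       (λ { (p , refl) → sym (gf x p) }) (λ { refl → Q⇒P y q , fg y q }))))
                (enumˣ (g y))
  ... | no ¬q = trans (∑-cong xs (λ x → trans (sym (χ-× (P? x) (f x ≟ᴮ y)))
                  (χ-no (P? x ×-dec f x ≟ᴮ y) (λ { (p , refl) → ¬q (P⇒Q x p) }))))
                (∑-zero xs)

_⊆?_ : ∀ {k} (c : Subset k) {D : Fin k → Set} (D? : Decidable D) → Dec (∀ v → lookup c v ≡ true → D v)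
c ⊆? D? = FP.all? (λ v → (lookup c v Bool.≟ true) →-dec D? v)

⊆?-∷ : ∀ {k} {D : Fin (suc k) → Set} (D? : Decidable D) b (c : Subset k) →
  χ ((b V.∷ c) ⊆? D?) ≡ χ ((b Bool.≟ true) →-dec D? F.zero) * χ (c ⊆? (D? ∘ F.suc))
⊆?-∷ D? b c =
  trans (χ-⇔ ((b V.∷ c) ⊆? D?) (((b Bool.≟ true) →-dec D? F.zero) ×-dec (c ⊆? (D? ∘ F.suc)))
             (λ h → h F.zero , h ∘ F.suc) (λ { (h₀ , hₛ) F.zero → h₀ ; (h₀ , hₛ) (F.suc v) → hₛ v }))
        (χ-× ((b Bool.≟ true) →-dec D? F.zero) (c ⊆? (D? ∘ F.suc)))

count-subsets-within : ∀ k {D : Fin k → Set} (D? : Decidable D) →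
  ∑ (subsets k) (λ c → χ (c ⊆? D?)) ≡ 2 ^ ∑ (allFin k) (λ v → χ (D? v))
count-subsets-within zero    D? = refl
count-subsets-within (suc k) D? = begin
    ∑ (subsets (suc k)) (λ c → χ (c ⊆? D?))
      ≡⟨ ∑-map _ (cartesianProduct bools (subsets k)) _ ⟩
    ∑ (cartesianProduct bools (subsets k)) (λ p → χ ((proj₁ p V.∷ proj₂ p) ⊆? D?))
      ≡⟨ ∑-cartesian bools (subsets k) _ ⟩
    ∑ bools (λ b → ∑ (subsets k) (λ c → χ ((b V.∷ c) ⊆? D?)))
      ≡⟨ ∑-cong bools split ⟩
    ∑ bools (λ b → χ ((b Bool.≟ true) →-dec D? F.zero) * 2 ^ r)
      ≡⟨ double (does (D? F.zero)) (2 ^ r) ⟩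
    2 ^ χ (D? F.zero) * 2 ^ r
      ≡⟨ ℕP.^-distribˡ-+-* 2 (χ (D? F.zero)) r ⟨
    2 ^ (χ (D? F.zero) + r)
      ≡⟨ cong (2 ^_) (∑-allFin-suc {k} (λ v → χ (D? v))) ⟨
    2 ^ ∑ (allFin (suc k)) (λ v → χ (D? v)) ∎
  where
  open ≡-Reasoning
  bools = true ∷ false ∷ []
  r = ∑ (allFin k) (λ v → χ (D? (F.suc v)))
  split : ∀ b → ∑ (subsets k) (λ c → χ ((b V.∷ c) ⊆? D?)) ≡ χ ((b Bool.≟ true) →-dec D? F.zero) * 2 ^ r
  split b = trans (∑-cong (subsets k) (⊆?-∷ D? b))
              (trans (∑-*ˡ (subsets k) head _) (cong (head *_) (count-subsets-within k (D? ∘ F.suc))))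
    where head = χ ((b Bool.≟ true) →-dec D? F.zero)
  -- the first point may be left out, and may be put in exactly when it lies in D
  double : ∀ d x → bit d * x + (1 * x + 0) ≡ 2 ^ bit d * x
  double true  = solve-∀
  double false = solve-∀

module _ {m : ℕ} {R : Fin m → Set} (R? : Decidable R) where

  record ExactlyTwo : Set where
    constructor twoAt
    field
      fst snd   : Fin m
      fst<snd   : fst F.< snd
      holds-fst : R fst
      holds-snd : R snd
      only      : ∀ e → R e → e ≡ fst ⊎ e ≡ snd

  ∑-none : (∀ e → ¬ R e) → (h : Fin m → ℕ) → ∑ (allFin m) (λ e → χ (R? e) * h e) ≡ 0
  ∑-none none h = trans (∑-cong (allFin m) (λ e → cong (_* h e) (χ-no (R? e) (none e)))) (∑-zero (allFin m))

  ∑-two : (t : ExactlyTwo) (h : Fin m → ℕ) →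
    ∑ (allFin m) (λ e → χ (R? e) * h e) ≡ h (ExactlyTwo.fst t) + h (ExactlyTwo.snd t)
  ∑-two (twoAt p q p<q Rp Rq only) h = begin
      ∑ (allFin m) (λ e → χ (R? e) * h e)                            ≡⟨ ∑-cong (allFin m) split ⟩
      ∑ (allFin m) (λ e → χ (e ≟ p) * h e + χ (e ≟ q) * h e)          ≡⟨ ∑-+ (allFin m) _ _ ⟩
      ∑ (allFin m) (λ e → χ (e ≟ p) * h e) + ∑ (allFin m) (λ e → χ (e ≟ q) * h e)
        ≡⟨ cong₂ _+_ (∑-point _≟_ (allFin m) (allFin-enumerates m) p h)
                     (∑-point _≟_ (allFin m) (allFin-enumerates m) q h) ⟩
      h p + h q                                                       ∎
    where
    open ≡-Reasoning
    split : ∀ e → χ (R? e) * h e ≡ χ (e ≟ p) * h e + χ (e ≟ q) * h e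
    split e with R? e
    split e | yes Re with only e Re
    ... | inj₁ refl rewrite χ-yes (e ≟ e) refl | χ-no (e ≟ q) (FP.<⇒≢ p<q) = sym (ℕP.+-identityʳ _)
    ... | inj₂ refl rewrite χ-yes (e ≟ e) refl | χ-no (e ≟ p) (FP.<⇒≢ p<q ∘ sym) = refl
    split e | no ¬Re rewrite χ-no (e ≟ p) (λ { refl → ¬Re Rp }) | χ-no (e ≟ q) (λ { refl → ¬Re Rq }) = refl

none-of-count : ∀ {m} {R : Fin m → Set} (R? : Decidable R) → ∑ (allFin m) (λ e → χ (R? e)) ≡ 0 → ∀ e → ¬ R e
none-of-count {suc m} R? c e Re with R? F.zero | ∑-allFin-suc {m} (λ e → χ (R? e))
none-of-count {suc m} R? c F.zero    Re | no ¬R₀ | _  = ¬R₀ Re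
none-of-count {suc m} R? c (F.suc e) Re | no ¬R₀ | eq = none-of-count (R? ∘ F.suc) (trans (sym eq) c) e Re
none-of-count {suc m} R? c e         Re | yes _  | eq with trans (sym eq) c
... | ()

one-of-count : ∀ {m} {R : Fin m → Set} (R? : Decidable R) → ∑ (allFin m) (λ e → χ (R? e)) ≡ 1 →
  Σ (Fin m) λ p → R p × (∀ e → R e → e ≡ p)
one-of-count {suc m} R? c with R? F.zero | ∑-allFin-suc {m} (λ e → χ (R? e))
... | yes R₀ | eq =
  F.zero , R₀ , λ { F.zero _ → refl
                  ; (F.suc e) Re → ⊥-elim (none-of-count (R? ∘ F.suc) (ℕP.suc-injective (trans (sym eq) c)) e Re) }
... | no ¬R₀ | eq with one-of-count (R? ∘ F.suc) (trans (sym eq) c)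
... | p , Rp , only = F.suc p , Rp , λ { F.zero R₀ → ⊥-elim (¬R₀ R₀) ; (F.suc e) Re → cong F.suc (only e Re) }

two-of-count : ∀ {m} {R : Fin m → Set} (R? : Decidable R) → ∑ (allFin m) (λ e → χ (R? e)) ≡ 2 → ExactlyTwo R?
two-of-count {suc m} R? c with R? F.zero | ∑-allFin-suc {m} (λ e → χ (R? e))
... | yes R₀ | eq with one-of-count (R? ∘ F.suc) (ℕP.suc-injective (trans (sym eq) c))
... | p , Rp , only =
  twoAt F.zero (F.suc p) (ℕ.s≤s ℕ.z≤n) R₀ Rp
        λ { F.zero _ → inj₁ refl ; (F.suc e) Re → inj₂ (cong F.suc (only e Re)) }
two-of-count {suc m} R? c | no ¬R₀ | eq with two-of-count (R? ∘ F.suc) (trans (sym eq) c)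
... | twoAt p q p<q Rp Rq only =
  twoAt (F.suc p) (F.suc q) (ℕ.s≤s p<q) Rp Rq
        λ { F.zero R₀ → ⊥-elim (¬R₀ R₀) ; (F.suc e) Re → ⊎-map (cong F.suc) (cong F.suc) (only e Re) }

∑ℤ : List A → (A → ℤ) → ℤ
∑ℤ []       f = pos 0
∑ℤ (x ∷ xs) f = f x ℤ.+ ∑ℤ xs f

sumℤ-map : ∀ (xs : List A) (f : A → ℤ) → sumℤ (map f xs) ≡ ∑ℤ xs f
sumℤ-map []       f = refl
sumℤ-map (x ∷ xs) f = cong (ℤ._+_ (f x)) (sumℤ-map xs f)

∑ℤ-cong : ∀ (xs : List A) {f g : A → ℤ} → (∀ x → f x ≡ g x) → ∑ℤ xs f ≡ ∑ℤ xs g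
∑ℤ-cong []       h = refl
∑ℤ-cong (x ∷ xs) h = cong₂ ℤ._+_ (h x) (∑ℤ-cong xs h)

∑ℤ-zero : ∀ (xs : List A) → ∑ℤ xs (λ _ → pos 0) ≡ pos 0
∑ℤ-zero []       = refl
∑ℤ-zero (x ∷ xs) = trans (ℤP.+-identityˡ _) (∑ℤ-zero xs)

∑ℤ-++ : ∀ (xs ys : List A) (f : A → ℤ) → ∑ℤ (xs ++ ys) f ≡ ∑ℤ xs f ℤ.+ ∑ℤ ys f
∑ℤ-++ []       ys f = sym (ℤP.+-identityˡ _)
∑ℤ-++ (x ∷ xs) ys f = trans (cong (ℤ._+_ (f x)) (∑ℤ-++ xs ys f)) (sym (ℤP.+-assoc (f x) _ _))

∑ℤ-map : ∀ (g : A → B) xs (f : B → ℤ) → ∑ℤ (map g xs) f ≡ ∑ℤ xs (λ x → f (g x))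
∑ℤ-map g []       f = refl
∑ℤ-map g (x ∷ xs) f = cong (ℤ._+_ (f (g x))) (∑ℤ-map g xs f)

∑ℤ-cartesian : ∀ (xs : List A) (ys : List B) (f : A × B → ℤ) →
  ∑ℤ (cartesianProduct xs ys) f ≡ ∑ℤ xs (λ x → ∑ℤ ys (λ y → f (x , y)))
∑ℤ-cartesian []       ys f = refl
∑ℤ-cartesian (x ∷ xs) ys f =
  trans (∑ℤ-++ (map (x ,_) ys) _ f) (cong₂ ℤ._+_ (∑ℤ-map (x ,_) ys f) (∑ℤ-cartesian xs ys f))

module Reduction (G : Graph) where
  open Graph G using (n; m; ends; loopless)

  end₁ end₂ : Fin m → Fin n
  end₁ e = proj₁ (ends e)
  end₂ e = proj₂ (ends e)

  -- Blocks.  Above an edge e = ab of G lie the four edges a^s b^t of G'; a subset of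
  -- them is a block, entry [s][t] standing for a^s b^t.

  Block : Set
  Block = Vec (Subset 2) 2

  copy : Bool → Fin 2
  copy false = F.zero
  copy true  = F.suc F.zero

  -- `single true x y` contains only a^x b^y; `single false x y` is empty.
  single : Bool → Bool → Bool → Block
  single false _     _     = (false V.∷ false V.∷ V.[]) V.∷ (false V.∷ false V.∷ V.[]) V.∷ V.[]
  single true  false false = (true  V.∷ false V.∷ V.[]) V.∷ (false V.∷ false V.∷ V.[]) V.∷ V.[]
  single true  false true  = (false V.∷ true  V.∷ V.[]) V.∷ (false V.∷ false V.∷ V.[]) V.∷ V.[]
  single true  true  false = (false V.∷ false V.∷ V.[]) V.∷ (true  V.∷ false V.∷ V.[]) V.∷ V.[]
  single true  true  true  = (false V.∷ false V.∷ V.[]) V.∷ (false V.∷ true  V.∷ V.[]) V.∷ V.[]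

  -- whether a block is nonempty (this is how π sees it), and which copies of a and b it touches
  used : Block → Bool
  used B = does (FP.any? (λ s → FP.any? (λ t → t ∈? lookup B s)))

  copy₁ copy₂ : Block → Bool
  copy₁ ((_ V.∷ _ V.∷ V.[]) V.∷ (x₁₀ V.∷ x₁₁ V.∷ V.[]) V.∷ V.[]) = x₁₀ Bool.∨ x₁₁
  copy₂ ((_ V.∷ x₀₁ V.∷ V.[]) V.∷ (_ V.∷ x₁₁ V.∷ V.[]) V.∷ V.[]) = x₀₁ Bool.∨ x₁₁

  pairs : List (Fin 2 × Fin 2)
  pairs = cartesianProduct (allFin 2) (allFin 2)

  blockSize : Block → ℕ
  blockSize B = count (λ st → proj₂ st ∈? lookup B (proj₁ st)) pairs

  single-of-size≤1 : ∀ B → blockSize B ≤ 1 → B ≡ single (used B) (copy₁ B) (copy₂ B)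
  single-of-size≤1 ((false V.∷ false V.∷ V.[]) V.∷ (false V.∷ false V.∷ V.[]) V.∷ V.[]) _ = refl
  single-of-size≤1 ((false V.∷ false V.∷ V.[]) V.∷ (false V.∷ true  V.∷ V.[]) V.∷ V.[]) _ = refl
  single-of-size≤1 ((false V.∷ false V.∷ V.[]) V.∷ (true  V.∷ false V.∷ V.[]) V.∷ V.[]) _ = refl
  single-of-size≤1 ((false V.∷ false V.∷ V.[]) V.∷ (true  V.∷ true  V.∷ V.[]) V.∷ V.[]) (ℕ.s≤s ())
  single-of-size≤1 ((false V.∷ true  V.∷ V.[]) V.∷ (false V.∷ false V.∷ V.[]) V.∷ V.[]) _ = refl
  single-of-size≤1 ((false V.∷ true  V.∷ V.[]) V.∷ (false V.∷ true  V.∷ V.[]) V.∷ V.[]) (ℕ.s≤s ())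
  single-of-size≤1 ((false V.∷ true  V.∷ V.[]) V.∷ (true  V.∷ false V.∷ V.[]) V.∷ V.[]) (ℕ.s≤s ())
  single-of-size≤1 ((false V.∷ true  V.∷ V.[]) V.∷ (true  V.∷ true  V.∷ V.[]) V.∷ V.[]) (ℕ.s≤s ())
  single-of-size≤1 ((true  V.∷ false V.∷ V.[]) V.∷ (false V.∷ false V.∷ V.[]) V.∷ V.[]) _ = refl
  single-of-size≤1 ((true  V.∷ false V.∷ V.[]) V.∷ (false V.∷ true  V.∷ V.[]) V.∷ V.[]) (ℕ.s≤s ())
  single-of-size≤1 ((true  V.∷ false V.∷ V.[]) V.∷ (true  V.∷ false V.∷ V.[]) V.∷ V.[]) (ℕ.s≤s ())
  single-of-size≤1 ((true  V.∷ false V.∷ V.[]) V.∷ (true  V.∷ true  V.∷ V.[]) V.∷ V.[]) (ℕ.s≤s ())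
  single-of-size≤1 ((true  V.∷ true  V.∷ V.[]) V.∷ (false V.∷ false V.∷ V.[]) V.∷ V.[]) (ℕ.s≤s ())
  single-of-size≤1 ((true  V.∷ true  V.∷ V.[]) V.∷ (false V.∷ true  V.∷ V.[]) V.∷ V.[]) (ℕ.s≤s ())
  single-of-size≤1 ((true  V.∷ true  V.∷ V.[]) V.∷ (true  V.∷ false V.∷ V.[]) V.∷ V.[]) (ℕ.s≤s ())
  single-of-size≤1 ((true  V.∷ true  V.∷ V.[]) V.∷ (true  V.∷ true  V.∷ V.[]) V.∷ V.[]) (ℕ.s≤s ())

  used-single : ∀ f x y → used (single f x y) ≡ f
  used-single false _     _     = refl
  used-single true  false false = refl
  used-single true  false true  = refl
  used-single true  true  false = refl
  used-single true  true  true  = refl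

  copies-single : ∀ x y → copy₁ (single true x y) ≡ x × copy₂ (single true x y) ≡ y
  copies-single false false = refl , refl
  copies-single false true  = refl , refl
  copies-single true  false = refl , refl
  copies-single true  true  = refl , refl

  ∑-single : ∀ f x y (g : Fin 2 × Fin 2 → ℕ) →
    ∑ pairs (λ st → χ (proj₂ st ∈? lookup (single f x y) (proj₁ st)) * g st) ≡ bit f * g (copy x , copy y)
  ∑-single false _     _     g = refl
  ∑-single true  false false g = ℕP.+-identityʳ _
  ∑-single true  false true  g = ℕP.+-identityʳ _
  ∑-single true  true  false g = ℕP.+-identityʳ _
  ∑-single true  true  true  g = ℕP.+-identityʳ _

  ∑ℤ-single : ∀ f x y (w : ℤ) →
    ∑ℤ pairs (λ st → if does (proj₂ st ∈? lookup (single f x y) (proj₁ st)) then w else pos 0) ≡ (if f then w else pos 0)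
  ∑ℤ-single false _     _     w = refl
  ∑ℤ-single true  false false w = ℤP.+-identityʳ w
  ∑ℤ-single true  false true  w = trans (ℤP.+-identityˡ _) (ℤP.+-identityʳ w)
  ∑ℤ-single true  true  false w = trans (ℤP.+-identityˡ _) (trans (ℤP.+-identityˡ _) (ℤP.+-identityʳ w))
  ∑ℤ-single true  true  true  w =
    trans (ℤP.+-identityˡ _) (trans (ℤP.+-identityˡ _) (trans (ℤP.+-identityˡ _) (ℤP.+-identityʳ w)))

  blockSize-single : ∀ f x y → blockSize (single f x y) ≡ bit f
  blockSize-single false _     _     = refl
  blockSize-single true  false false = refl
  blockSize-single true  false true  = refl
  blockSize-single true  true  false = refl
  blockSize-single true  true  true  = refl

  block : Sub' G → Fin m → Block
  block M e = lookup (proj₂ M) e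

  -- M uses exactly the edges e with Fb e, each through the copies X e and Y e of its ends.
  SingleBlocks : Sub' G → (Fb X Y : Fin m → Bool) → Set
  SingleBlocks M Fb X Y = ∀ e → block M e ≡ single (Fb e) (X e) (Y e)

  π-lookup : ∀ M e → lookup (π G M) e ≡ used (block M e)
  π-lookup M e = VP.lookup∘tabulate _ e

  simple-singles : ∀ M → IsSimple G M → SingleBlocks M (lookup (π G M)) (copy₁ ∘ block M) (copy₂ ∘ block M)
  simple-singles M simple e =
    trans (single-of-size≤1 (block M e) (simple e)) (cong (λ f → single f (copy₁ (block M e)) (copy₂ (block M e))) (sym (π-lookup M e)))

  singles-simple : ∀ {M Fb X Y} → SingleBlocks M Fb X Y → IsSimple G M
  singles-simple {Fb = Fb} d e =
    subst (λ B → blockSize B ≤ 1) (sym (d e)) (subst (_≤ 1) (sym (blockSize-single (Fb e) _ _)) (bit≤1 (Fb e)))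

  singles-π : ∀ {M F X Y} → SingleBlocks M (lookup F) X Y → π G M ≡ F
  singles-π {M} {F} d = vec-ext _ _ λ e → trans (π-lookup M e) (trans (cong used (d e)) (used-single (lookup F e) _ _))

  singles-copies : ∀ {M Fb X Y} → SingleBlocks M Fb X Y → ∀ e → Fb e ≡ true →
    copy₁ (block M e) ≡ X e × copy₂ (block M e) ≡ Y e
  singles-copies {M} {Fb} {X} {Y} d e used-e rewrite d e | used-e = copies-single (X e) (Y e)

  size-as-∑ : ∀ F → size G F ≡ ∑ (allFin m) (λ e → bit (lookup F e))
  size-as-∑ F = trans (count-as-∑ _ (allFin m)) (∑-cong (allFin m) (λ e → χ-∈ e F))

  size₁-as-∑ : ∀ M → size₁ G M ≡ ∑ (allFin m) (λ e → blockSize (block M e))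
  size₁-as-∑ M = begin
      size₁ G M                                               ≡⟨ count-as-∑ _ (map inj₂ edges₁) ⟩
      ∑ (map inj₂ edges₁) member                              ≡⟨ ∑-map inj₂ edges₁ member ⟩
      ∑ edges₁ (member ∘ inj₂)                                ≡⟨ ∑-cartesian (allFin m) pairs _ ⟩
      ∑ (allFin m) (λ e → ∑ pairs (λ st → member (inj₂ (e , st))))
        ≡⟨ ∑-cong (allFin m) (λ e → sym (count-as-∑ (λ st → proj₂ st ∈? lookup (block M e) (proj₁ st)) pairs)) ⟩
      ∑ (allFin m) (λ e → blockSize (block M e))              ∎
    where
    open ≡-Reasoning
    edges₁ = cartesianProduct (allFin m) pairs
    member : E' G → ℕ
    member x = χ (_∈'?_ G x M)

  size₁-singles : ∀ {M F X Y} → SingleBlocks M (lookup F) X Y → size₁ G M ≡ size G F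
  size₁-singles {M} {F} d = trans (size₁-as-∑ M) (trans
    (∑-cong (allFin m) (λ e → trans (cong blockSize (d e)) (blockSize-single (lookup F e) _ _)))
    (sym (size-as-∑ F)))

  weight'-as-∑ : ∀ ω M → weight' G ω M ≡
    ∑ℤ (allFin m) (λ e → ∑ℤ pairs (λ st → if does (proj₂ st ∈? lookup (block M e) (proj₁ st)) then ω e else pos 0))
  weight'-as-∑ ω M = begin
      weight' G ω M                                  ≡⟨ sumℤ-map (allE' G) h ⟩
      ∑ℤ (allE' G) h                                  ≡⟨ ∑ℤ-++ (map inj₁ (allFin n)) (map inj₂ edges₁) h ⟩
      ∑ℤ (map inj₁ (allFin n)) h ℤ.+ ∑ℤ (map inj₂ edges₁) h
        ≡⟨ cong₂ ℤ._+_ (trans (∑ℤ-map inj₁ (allFin n) h) (trans (∑ℤ-cong (allFin n) weightless) (∑ℤ-zero (allFin n))))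
                       (trans (∑ℤ-map inj₂ edges₁ h) (∑ℤ-cartesian (allFin m) pairs _)) ⟩
      pos 0 ℤ.+ ∑ℤ (allFin m) (λ e → ∑ℤ pairs (λ st → h (inj₂ (e , st))))
        ≡⟨ ℤP.+-identityˡ _ ⟩
      ∑ℤ (allFin m) (λ e → ∑ℤ pairs (λ st → h (inj₂ (e , st)))) ∎
    where
    open ≡-Reasoning
    edges₁ = cartesianProduct (allFin m) pairs
    h : E' G → ℤ
    h x = if does (_∈'?_ G x M) then ω' G ω x else pos 0
    weightless : ∀ u → h (inj₁ u) ≡ pos 0
    weightless u with does (_∈'?_ G (inj₁ u) M)
    ... | true  = refl
    ... | false = refl

  weight'-singles : ∀ ω {M F X Y} → SingleBlocks M (lookup F) X Y → weight' G ω M ≡ weight G ω F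
  weight'-singles ω {M} {F} d = trans (weight'-as-∑ ω M) (trans
    (∑ℤ-cong (allFin m) (λ e → trans (cong (λ B → ∑ℤ pairs (λ st → if does (proj₂ st ∈? lookup B (proj₁ st)) then ω e else pos 0)) (d e))
                                     (∑ℤ-single (lookup F e) _ _ (ω e))))
    (sym (sumℤ-map (allFin m) _)))

  _≟ᵥ_ : DecidableEquality (V' G)
  _≟ᵥ_ = PP.≡-dec _≟_ _≟_

  blockDegree : Block → (a b : Fin n) → V' G → ℕ
  blockDegree B a b x =
    ∑ pairs (λ st → χ ((proj₂ st ∈? lookup B (proj₁ st)) ×-dec (x ≟ᵥ (a , proj₁ st) ⊎-dec x ≟ᵥ (b , proj₂ st))))

  deg'-split : ∀ M u s →
    deg' G M (u , s) ≡ bit (lookup (proj₁ M) u) + ∑ (allFin m) (λ e → blockDegree (block M e) (end₁ e) (end₂ e) (u , s))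
  deg'-split M u s = begin
      deg' G M (u , s)                                                  ≡⟨ count-as-∑ _ (allE' G) ⟩
      ∑ (allE' G) h                                                     ≡⟨ ∑-++ (map inj₁ (allFin n)) (map inj₂ edges₁) h ⟩
      ∑ (map inj₁ (allFin n)) h + ∑ (map inj₂ edges₁) h
        ≡⟨ cong₂ _+_ (trans (∑-map inj₁ (allFin n) h) (trans (∑-cong (allFin n) vertical) own))
                     (trans (∑-map inj₂ edges₁ h) (∑-cartesian (allFin m) pairs _)) ⟩
      bit (lookup (proj₁ M) u) + ∑ (allFin m) (λ e → blockDegree (block M e) (end₁ e) (end₂ e) (u , s)) ∎
    where
    open ≡-Reasoning
    edges₁ = cartesianProduct (allFin m) pairs
    h : E' G → ℕ
    h x = χ ((_∈'?_ G x M) ×-dec incident'? G (u , s) x)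
    vertical : ∀ u' → h (inj₁ u') ≡ χ (u' ≟ u) * bit (lookup (proj₁ M) u)
    vertical u' with u' ≟ u
    ... | yes refl = trans (χ-× (u ∈? proj₁ M) (incident'? G (u , s) (inj₁ u)))
                       (trans (cong₂ _*_ (χ-∈ u (proj₁ M)) (χ-yes (incident'? G (u , s) (inj₁ u)) (endpoint s)))
                              (ℕP.*-comm _ 1))
      where
      endpoint : ∀ s → Incident' G (u , s) (inj₁ u)
      endpoint F.zero           = inj₁ refl
      endpoint (F.suc F.zero)   = inj₂ refl
    ... | no u'≢u = trans (χ-× (u' ∈? proj₁ M) (incident'? G (u , s) (inj₁ u')))
                      (trans (cong (χ (u' ∈? proj₁ M) *_) (χ-no (incident'? G (u , s) (inj₁ u')) λ { (inj₁ refl) → u'≢u refl ; (inj₂ refl) → u'≢u refl }))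
                             (ℕP.*-zeroʳ (χ (u' ∈? proj₁ M))))
    own = ∑-point _≟_ (allFin n) (allFin-enumerates n) u (λ _ → bit (lookup (proj₁ M) u))

  -- Edges of G: those of Fb at u, and the copy of u that an edge e at u uses when its
  -- ends use the copies X e and Y e.

  At : (Fin m → Bool) → Fin n → Fin m → Set
  At Fb u e = Fb e ≡ true × Incident G u e

  at? : ∀ Fb u → Decidable (At Fb u)
  at? Fb u e = (Fb e Bool.≟ true) ×-dec incident? G u e

  deg-as-∑ : ∀ F u → deg G F u ≡ ∑ (allFin m) (λ e → χ (at? (lookup F) u e))
  deg-as-∑ F u = trans (count-as-∑ _ (allFin m)) (∑-cong (allFin m) λ e →
    trans (χ-× (e ∈? F) (incident? G u e))
          (trans (cong (_* χ (incident? G u e)) (trans (χ-∈ e F) (sym (χ-true (lookup F e)))))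
                 (sym (χ-× (lookup F e Bool.≟ true) (incident? G u e)))))

  portAt : (X Y : Fin m → Bool) → Fin n → Fin m → Bool
  portAt X Y u e = if does (u ≟ end₁ e) then X e else Y e

  attached : (Fb X Y : Fin m → Bool) → Fin n → Fin 2 → ℕ
  attached Fb X Y u s = ∑ (allFin m) (λ e → χ (at? Fb u e) * χ (s ≟ copy (portAt X Y u e)))

  blockDegree-single : ∀ (Fb X Y : Fin m → Bool) u s e →
    blockDegree (single (Fb e) (X e) (Y e)) (end₁ e) (end₂ e) (u , s) ≡ χ (at? Fb u e) * χ (s ≟ copy (portAt X Y u e))
  blockDegree-single Fb X Y u s e =
    trans (∑-cong pairs entry) (trans (∑-single (Fb e) (X e) (Y e) (λ st → χ (u ≟ a) * χ (s ≟ proj₁ st) + χ (u ≟ b) * χ (s ≟ proj₂ st))) ends-of-e)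
    where
    a = end₁ e
    b = end₂ e
    entry : ∀ st → χ ((proj₂ st ∈? lookup (single (Fb e) (X e) (Y e)) (proj₁ st)) ×-dec ((u , s) ≟ᵥ (a , proj₁ st) ⊎-dec (u , s) ≟ᵥ (b , proj₂ st)))
                 ≡ χ (proj₂ st ∈? lookup (single (Fb e) (X e) (Y e)) (proj₁ st))
                   * (χ (u ≟ a) * χ (s ≟ proj₁ st) + χ (u ≟ b) * χ (s ≟ proj₂ st))
    entry (s' , t) = trans (χ-× (t ∈? lookup (single (Fb e) (X e) (Y e)) s') ((u , s) ≟ᵥ (a , s') ⊎-dec (u , s) ≟ᵥ (b , t)))
      (cong (χ (t ∈? lookup (single (Fb e) (X e) (Y e)) s') *_) (trans (χ-⊎ ((u , s) ≟ᵥ (a , s')) ((u , s) ≟ᵥ (b , t)) (λ { (refl , eq) → loopless e (cong proj₁ eq) }))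
                          (cong₂ _+_ (pair a s') (pair b t))))
      where
      pair : ∀ c s' → χ ((u , s) ≟ᵥ (c , s')) ≡ χ (u ≟ c) * χ (s ≟ s')
      pair c s' = trans (χ-⇔ ((u , s) ≟ᵥ (c , s')) (u ≟ c ×-dec s ≟ s') (λ { refl → refl , refl }) (λ { (refl , refl) → refl }))
                        (χ-× (u ≟ c) (s ≟ s'))
    ends-of-e : bit (Fb e) * (χ (u ≟ a) * χ (s ≟ copy (X e)) + χ (u ≟ b) * χ (s ≟ copy (Y e)))
                ≡ χ (at? Fb u e) * χ (s ≟ copy (portAt X Y u e))
    ends-of-e rewrite χ-× (Fb e Bool.≟ true) (incident? G u e) | χ-true (Fb e) with u ≟ a | u ≟ b
    ... | yes refl | yes a≡b = ⊥-elim (loopless e a≡b)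
    ... | yes refl | no _    = at-first (bit (Fb e)) (χ (s ≟ copy (X e)))
      where
      at-first : ∀ f x → f * (1 * x + 0 * x) ≡ (f * 1) * x
      at-first = solve-∀
    ... | no _     | yes refl = at-second (bit (Fb e)) (χ (s ≟ copy (Y e)))
      where
      at-second : ∀ f x → f * (0 * x + 1 * x) ≡ (f * 1) * x
      at-second = solve-∀
    ... | no _     | no _    = elsewhere (bit (Fb e)) (χ (s ≟ copy (X e))) (χ (s ≟ copy (Y e))) _
      where
      elsewhere : ∀ f x y z → f * (0 * x + 0 * y) ≡ (f * 0) * z
      elsewhere = solve-∀

  deg'-singles : ∀ {M Fb X Y} → SingleBlocks M Fb X Y → ∀ u s →
    deg' G M (u , s) ≡ bit (lookup (proj₁ M) u) + attached Fb X Y u s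
  deg'-singles {M} {Fb} {X} {Y} d u s = trans (deg'-split M u s) (cong (bit (lookup (proj₁ M) u) +_)
    (∑-cong (allFin m) λ e → trans (cong (λ B → blockDegree B (end₁ e) (end₂ e) (u , s)) (d e))
                                   (blockDegree-single Fb X Y u s e)))

  -- Each edge at u uses one of the two copies of u.
  attached-total : ∀ Fb X Y u → attached Fb X Y u F.zero + attached Fb X Y u (F.suc F.zero) ≡ ∑ (allFin m) (λ e → χ (at? Fb u e))
  attached-total Fb X Y u = trans (sym (∑-+ (allFin m) _ _)) (∑-cong (allFin m) λ e →
    trans (sym (ℕP.*-distribˡ-+ (χ (at? Fb u e)) _ _))
          (trans (cong (χ (at? Fb u e) *_) (one-copy (copy (portAt X Y u e)))) (ℕP.*-identityʳ _)))
    where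
    one-copy : ∀ (c : Fin 2) → χ (F.zero ≟ c) + χ (F.suc F.zero ≟ c) ≡ 1
    one-copy F.zero         = refl
    one-copy (F.suc F.zero) = refl

  attached-two : ∀ Fb X Y u (t : ExactlyTwo (at? Fb u)) s →
    attached Fb X Y u s ≡ χ (s ≟ copy (portAt X Y u (ExactlyTwo.fst t))) + χ (s ≟ copy (portAt X Y u (ExactlyTwo.snd t)))
  attached-two Fb X Y u t s = ∑-two (at? Fb u) t (λ e → χ (s ≟ copy (portAt X Y u e)))

  attached-none : ∀ Fb X Y u → (∀ e → ¬ At Fb u e) → ∀ s → attached Fb X Y u s ≡ 0
  attached-none Fb X Y u none s = ∑-none (at? Fb u) none (λ e → χ (s ≟ copy (portAt X Y u e)))

  portAt-end₁ : ∀ X Y e → portAt X Y (end₁ e) e ≡ X e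
  portAt-end₁ X Y e = cong (if_then X e else Y e) (dec-true (end₁ e ≟ end₁ e) refl)

  portAt-end₂ : ∀ X Y e → portAt X Y (end₂ e) e ≡ Y e
  portAt-end₂ X Y e = cong (if_then X e else Y e) (dec-false (end₂ e ≟ end₁ e) (loopless e ∘ sym))

  portAt-singles : ∀ {M Fb X Y} → SingleBlocks M Fb X Y → ∀ u e → Fb e ≡ true →
    portAt (copy₁ ∘ block M) (copy₂ ∘ block M) u e ≡ portAt X Y u e
  portAt-singles {M} d u e used-e = cong₂ (λ x y → if does (u ≟ end₁ e) then x else y)
    (proj₁ (singles-copies {M} d e used-e)) (proj₂ (singles-copies {M} d e used-e))

  noneAt-of-deg : ∀ F u → deg G F u ≡ 0 → ∀ e → ¬ At (lookup F) u e
  noneAt-of-deg F u d0 = none-of-count (at? (lookup F) u) (trans (sym (deg-as-∑ F u)) d0)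

  twoAt-of-deg : ∀ F u → deg G F u ≡ 2 → ExactlyTwo (at? (lookup F) u)
  twoAt-of-deg F u d2 = two-of-count (at? (lookup F) u) (trans (sym (deg-as-∑ F u)) d2)

  later? : (Fb : Fin m → Bool) (u : Fin n) (e : Fin m) → Dec (∃ λ e' → e' F.< e × At Fb u e')
  later? Fb u e = FP.any? (λ e' → (e' FP.<? e) ×-dec at? Fb u e')

  module _ {Fb : Fin m → Bool} {u : Fin n} (t : ExactlyTwo (at? Fb u)) where
    open ExactlyTwo t

    nothing-before-fst : ¬ (∃ λ e' → e' F.< fst × At Fb u e')
    nothing-before-fst (e' , e'<fst , at-e') with only e' at-e'
    ... | inj₁ refl = FP.<-irrefl refl e'<fst
    ... | inj₂ refl = FP.<-asym e'<fst fst<snd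

    fst-first : does (later? Fb u fst) ≡ false
    fst-first = dec-false (later? Fb u fst) nothing-before-fst

    snd-later : does (later? Fb u snd) ≡ true
    snd-later = dec-true (later? Fb u snd) (fst , fst<snd , holds-fst)

  -- whether h holds at the first edge of Fb at u (false if there is none)
  firstWith? : (Fb : Fin m → Bool) (u : Fin n) (h : Fin m → Bool) →
    Dec (∃ λ e → (At Fb u e × ¬ (∃ λ e' → e' F.< e × At Fb u e')) × h e ≡ true)
  firstWith? Fb u h = FP.any? (λ e → (at? Fb u e ×-dec ¬? (later? Fb u e)) ×-dec (h e Bool.≟ true))

  atFirst : (Fb : Fin m → Bool) (u : Fin n) (h : Fin m → Bool) → Bool
  atFirst Fb u h = does (firstWith? Fb u h)

  atFirst-two : ∀ {Fb u} h (t : ExactlyTwo (at? Fb u)) → atFirst Fb u h ≡ h (ExactlyTwo.fst t)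
  atFirst-two {Fb} {u} h t@(twoAt p q p<q at-p at-q only) =
    trans (does-⇔ (firstWith? Fb u h) (h p Bool.≟ true) first-is-p (λ hp → p , (at-p , nothing-before-fst t) , hp)) (is-true (h p))
    where
    first-is-p : (∃ λ e → (At Fb u e × ¬ (∃ λ e' → e' F.< e × At Fb u e')) × h e ≡ true) → h p ≡ true
    first-is-p (e , (at-e , first) , he) with only e at-e
    ... | inj₁ refl = he
    ... | inj₂ refl = ⊥-elim (first (p , p<q , at-p))
    is-true : ∀ b → does (b Bool.≟ true) ≡ b
    is-true true  = refl
    is-true false = refl

  atFirst-none : ∀ {Fb u} h → (∀ e → ¬ At Fb u e) → atFirst Fb u h ≡ false
  atFirst-none {Fb} {u} h none = dec-false (firstWith? Fb u h) λ { (e , (at-e , _) , _) → none e at-e }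

  atFirst-true : ∀ {Fb u} h → atFirst Fb u h ≡ true → ∃ (At Fb u)
  atFirst-true {Fb} {u} h yes-h with does-true (firstWith? Fb u h) yes-h
  ... | e , (at-e , _) , _ = e , at-e

  chosen : Subset n → (Fin m → Bool) → Fin m → Fin n → Bool
  chosen c Fb e u = if does (later? Fb u e) then not (lookup c u) else lookup c u

  chosen₁ chosen₂ : Subset n → (Fin m → Bool) → Fin m → Bool
  chosen₁ c Fb e = chosen c Fb e (end₁ e)
  chosen₂ c Fb e = chosen c Fb e (end₂ e)

  portAt-chosen : ∀ c Fb u e → Incident G u e → portAt (chosen₁ c Fb) (chosen₂ c Fb) u e ≡ chosen c Fb e u
  portAt-chosen c Fb u e (inj₁ refl) = portAt-end₁ (chosen₁ c Fb) (chosen₂ c Fb) e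
  portAt-chosen c Fb u e (inj₂ refl) = portAt-end₂ (chosen₁ c Fb) (chosen₂ c Fb) e

  toMatching : Subset m → Subset n → Sub' G
  toMatching F c = tabulate (λ u → does (deg G F u ℕ.≟ 0))
                 , tabulate (λ e → single (lookup F e) (chosen₁ c (lookup F) e) (chosen₂ c (lookup F) e))

  toChoice : Sub' G → Subset n
  toChoice M = tabulate (λ u → atFirst (lookup (π G M)) u (portAt (copy₁ ∘ block M) (copy₂ ∘ block M) u))

  Within : Subset n → Subset m → Set
  Within c F = ∀ v → lookup c v ≡ true → deg G F v ≡ 2

  one-of-copies : ∀ x s → χ (s ≟ copy x) + χ (s ≟ copy (not x)) ≡ 1
  one-of-copies false F.zero         = refl
  one-of-copies false (F.suc F.zero) = refl
  one-of-copies true  F.zero         = refl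
  one-of-copies true  (F.suc F.zero) = refl

  module FromCover (F : Subset m) (c : Subset n) (cover : IsPartialCycleCover G F) (c-within : Within c F) where
    M = toMatching F c
    X = chosen₁ c (lookup F)
    Y = chosen₂ c (lookup F)

    singles : SingleBlocks M (lookup F) X Y
    singles e = VP.lookup∘tabulate _ e

    simple : IsSimple G M
    simple = singles-simple {M} singles

    π-M : π G M ≡ F
    π-M = singles-π {M} singles

    perfect : IsPerfectMatching G M
    perfect (u , s) = trans (deg'-singles {M} singles u s)
                            (trans (cong (λ b → bit b + attached (lookup F) X Y u s) (VP.lookup∘tabulate _ u)) (by-degree (cover u)))
      where
      by-degree : deg G F u ≡ 0 ⊎ deg G F u ≡ 2 → bit (does (deg G F u ℕ.≟ 0)) + attached (lookup F) X Y u s ≡ 1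
      by-degree (inj₁ d0) rewrite d0 = cong suc (attached-none (lookup F) X Y u (noneAt-of-deg F u d0) s)
      by-degree (inj₂ d2) rewrite d2 = begin
          attached (lookup F) X Y u s
            ≡⟨ attached-two (lookup F) X Y u t s ⟩
          χ (s ≟ copy (portAt X Y u fst)) + χ (s ≟ copy (portAt X Y u snd))
            ≡⟨ cong₂ (λ x y → χ (s ≟ copy x) + χ (s ≟ copy y)) (portAt-chosen c (lookup F) u fst (proj₂ holds-fst))
                                                                (portAt-chosen c (lookup F) u snd (proj₂ holds-snd)) ⟩
          χ (s ≟ copy (chosen c (lookup F) fst u)) + χ (s ≟ copy (chosen c (lookup F) snd u))
            ≡⟨ cong₂ (λ x y → χ (s ≟ copy (if x then _ else lookup c u)) + χ (s ≟ copy (if y then not (lookup c u) else _)))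
                     (fst-first t) (snd-later t) ⟩
          χ (s ≟ copy (lookup c u)) + χ (s ≟ copy (not (lookup c u)))
            ≡⟨ one-of-copies (lookup c u) s ⟩
          1 ∎
        where
        open ≡-Reasoning
        t = twoAt-of-deg F u d2
        open ExactlyTwo t

    choice-M : toChoice M ≡ c
    choice-M = vec-ext _ _ λ u → trans (VP.lookup∘tabulate _ u)
      (trans (cong (λ F' → atFirst (lookup F') u (portAt (copy₁ ∘ block M) (copy₂ ∘ block M) u)) π-M) (by-degree u (cover u)))
      where
      by-degree : ∀ u → deg G F u ≡ 0 ⊎ deg G F u ≡ 2 → atFirst (lookup F) u (portAt (copy₁ ∘ block M) (copy₂ ∘ block M) u) ≡ lookup c u
      by-degree u (inj₁ d0) = trans (atFirst-none _ (noneAt-of-deg F u d0)) (sym unchosen)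
        where
        unchosen : lookup c u ≡ false
        unchosen with lookup c u in cu
        ... | false = refl
        ... | true with trans (sym (c-within u cu)) d0
        ...   | ()
      by-degree u (inj₂ d2) = begin
          atFirst (lookup F) u (portAt (copy₁ ∘ block M) (copy₂ ∘ block M) u) ≡⟨ atFirst-two _ t ⟩
          portAt (copy₁ ∘ block M) (copy₂ ∘ block M) u fst                   ≡⟨ portAt-singles {M} singles u fst (proj₁ holds-fst) ⟩
          portAt (chosen₁ c (lookup F)) (chosen₂ c (lookup F)) u fst          ≡⟨ portAt-chosen c (lookup F) u fst (proj₂ holds-fst) ⟩
          chosen c (lookup F) fst u                                           ≡⟨ cong (if_then not (lookup c u) else lookup c u) (fst-first t) ⟩
          lookup c u                                                          ∎
        where
        open ≡-Reasoning
        t = twoAt-of-deg F u d2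
        open ExactlyTwo t

  module FromMatching (M : Sub' G) (simple : IsSimple G M) (perfect : IsPerfectMatching G M) where
    Fπ = lookup (π G M)
    X = copy₁ ∘ block M
    Y = copy₂ ∘ block M
    vertical = lookup (proj₁ M)

    singles : SingleBlocks M Fπ X Y
    singles = simple-singles M simple

    -- the degrees of u⁰ and u¹ (both 1) add up to 2·[u⁰u¹ ∈ M] + deg_{π(M)}(u)
    both-copies : ∀ u → bit (vertical u) + bit (vertical u) + deg G (π G M) u ≡ 2
    both-copies u = begin
        v + v + deg G (π G M) u
          ≡⟨ cong (v + v +_) (trans (deg-as-∑ (π G M) u) (sym (attached-total Fπ X Y u))) ⟩
        v + v + (attached Fπ X Y u F.zero + attached Fπ X Y u (F.suc F.zero))
          ≡⟨ interchange v v _ _ ⟩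
        (v + attached Fπ X Y u F.zero) + (v + attached Fπ X Y u (F.suc F.zero))
          ≡⟨ cong₂ _+_ (trans (sym (deg'-singles {M} singles u F.zero)) (perfect (u , F.zero)))
                       (trans (sym (deg'-singles {M} singles u (F.suc F.zero))) (perfect (u , F.suc F.zero))) ⟩
        2 ∎
      where
      open ≡-Reasoning
      v = bit (vertical u)
      interchange : ∀ a b c d → a + b + (c + d) ≡ (a + c) + (b + d)
      interchange = solve-∀

    cover : IsPartialCycleCover G (π G M)
    cover u with vertical u | both-copies u
    ... | true  | eq = inj₁ (ℕP.suc-injective (ℕP.suc-injective eq))
    ... | false | eq = inj₂ eq

    vertical-isolated : ∀ u → vertical u ≡ does (deg G (π G M) u ℕ.≟ 0)
    vertical-isolated u with vertical u | both-copies u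
    ... | true  | eq rewrite ℕP.suc-injective (ℕP.suc-injective eq) = refl
    ... | false | eq rewrite eq = refl

    degree-two : ∀ u e → At Fπ u e → deg G (π G M) u ≡ 2
    degree-two u e at-e with cover u
    ... | inj₁ d0 = ⊥-elim (noneAt-of-deg (π G M) u d0 e at-e)
    ... | inj₂ d2 = d2

    opposite : ∀ u (d2 : deg G (π G M) u ≡ 2) → let open ExactlyTwo (twoAt-of-deg (π G M) u d2) in
      portAt X Y u snd ≡ not (portAt X Y u fst)
    opposite u d2 = distinct x y (ℕP.suc-injective (trans (cong (_+ χ (copy x ≟ copy y)) (sym (χ-yes (copy x ≟ copy x) refl))) covered-once))
      where
      t = twoAt-of-deg (π G M) u d2
      open ExactlyTwo t
      x = portAt X Y u fst
      y = portAt X Y u snd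
      no-vertical : vertical u ≡ false
      no-vertical = trans (vertical-isolated u) (cong (λ d → does (d ℕ.≟ 0)) d2)
      covered-once : χ (copy x ≟ copy x) + χ (copy x ≟ copy y) ≡ 1
      covered-once = begin
          χ (copy x ≟ copy x) + χ (copy x ≟ copy y)  ≡⟨ attached-two Fπ X Y u t (copy x) ⟨
          attached Fπ X Y u (copy x)                 ≡⟨ cong (λ b → bit b + attached Fπ X Y u (copy x)) no-vertical ⟨
          bit (vertical u) + attached Fπ X Y u (copy x) ≡⟨ deg'-singles {M} singles u (copy x) ⟨
          deg' G M (u , copy x)                      ≡⟨ perfect (u , copy x) ⟩
          1 ∎
        where open ≡-Reasoning
      distinct : ∀ x y → χ (copy x ≟ copy y) ≡ 0 → y ≡ not x
      distinct false true  _ = refl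
      distinct true  false _ = refl

    choice-at : ∀ u (d2 : deg G (π G M) u ≡ 2) → lookup (toChoice M) u ≡ portAt X Y u (ExactlyTwo.fst (twoAt-of-deg (π G M) u d2))
    choice-at u d2 = trans (VP.lookup∘tabulate _ u) (atFirst-two _ (twoAt-of-deg (π G M) u d2))

    copies-chosen : ∀ u e → At Fπ u e → portAt X Y u e ≡ chosen (toChoice M) Fπ e u
    copies-chosen u e at-e = by-position (only e at-e)
      where
      d2 = degree-two u e at-e
      t = twoAt-of-deg (π G M) u d2
      open ExactlyTwo t
      c = toChoice M
      Goal : Fin m → Set
      Goal e = portAt X Y u e ≡ chosen c Fπ e u
      by-position : e ≡ fst ⊎ e ≡ snd → Goal e
      by-position (inj₁ e≡fst) = subst Goal (sym e≡fst) (begin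
          portAt X Y u fst          ≡⟨ choice-at u d2 ⟨
          lookup c u                ≡⟨ cong (if_then not (lookup c u) else lookup c u) (fst-first t) ⟨
          chosen c Fπ fst u         ∎)
        where open ≡-Reasoning
      by-position (inj₂ e≡snd) = subst Goal (sym e≡snd) (begin
          portAt X Y u snd          ≡⟨ opposite u d2 ⟩
          not (portAt X Y u fst)    ≡⟨ cong not (choice-at u d2) ⟨
          not (lookup c u)          ≡⟨ cong (if_then not (lookup c u) else lookup c u) (snd-later t) ⟨
          chosen c Fπ snd u         ∎)
        where open ≡-Reasoning

    roundtrip : toMatching (π G M) (toChoice M) ≡ M
    roundtrip = cong₂ _,_ (vec-ext _ _ λ u → trans (VP.lookup∘tabulate _ u) (sym (vertical-isolated u)))
                          (vec-ext _ _ λ e → trans (VP.lookup∘tabulate _ e) (trans (same-block e) (sym (singles e))))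
      where
      c = toChoice M
      same-block : ∀ e → single (Fπ e) (chosen₁ c Fπ e) (chosen₂ c Fπ e) ≡ single (Fπ e) (X e) (Y e)
      same-block e with Fπ e in used-e
      ... | false = refl
      ... | true  = cong₂ (single true)
        (trans (sym (copies-chosen (end₁ e) e (used-e , inj₁ refl))) (portAt-end₁ X Y e))
        (trans (sym (copies-chosen (end₂ e) e (used-e , inj₂ refl))) (portAt-end₂ X Y e))

  handshake : ∀ F → IsPartialCycleCover G F → ∑ (allFin n) (λ v → χ (deg G F v ℕ.≟ 2)) ≡ size G F
  handshake F cover = ℕP.*-cancelˡ-≡ _ _ 2 (begin
      2 * ∑ (allFin n) (λ v → χ (deg G F v ℕ.≟ 2))  ≡⟨ ∑-*ˡ (allFin n) 2 _ ⟨
      ∑ (allFin n) (λ v → 2 * χ (deg G F v ℕ.≟ 2))  ≡⟨ ∑-cong (allFin n) (λ v → twice-indicator (cover v)) ⟩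
      ∑ (allFin n) (λ v → deg G F v)               ≡⟨ ∑-cong (allFin n) (λ v → trans (deg-as-∑ F v) (∑-cong (allFin m) (split v))) ⟩
      ∑ (allFin n) (λ v → ∑ (allFin m) (λ e → bit (lookup F e) * χ (incident? G v e)))
        ≡⟨ ∑-swap (allFin n) (allFin m) _ ⟩
      ∑ (allFin m) (λ e → ∑ (allFin n) (λ v → bit (lookup F e) * χ (incident? G v e)))
        ≡⟨ ∑-cong (allFin m) (λ e → trans (∑-*ˡ (allFin n) (bit (lookup F e)) _) (cong (bit (lookup F e) *_) (two-ends e))) ⟩
      ∑ (allFin m) (λ e → bit (lookup F e) * 2)     ≡⟨ ∑-*ʳ (allFin m) 2 _ ⟩
      ∑ (allFin m) (λ e → bit (lookup F e)) * 2     ≡⟨ ℕP.*-comm (∑ (allFin m) (λ e → bit (lookup F e))) 2 ⟩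
      2 * ∑ (allFin m) (λ e → bit (lookup F e))     ≡⟨ cong (2 *_) (size-as-∑ F) ⟨
      2 * size G F                                  ∎)
    where
    open ≡-Reasoning
    twice-indicator : ∀ {v} → deg G F v ≡ 0 ⊎ deg G F v ≡ 2 → 2 * χ (deg G F v ℕ.≟ 2) ≡ deg G F v
    twice-indicator (inj₁ d0) rewrite d0 = refl
    twice-indicator (inj₂ d2) rewrite d2 = refl
    split : ∀ v e → χ (at? (lookup F) v e) ≡ bit (lookup F e) * χ (incident? G v e)
    split v e = trans (χ-× (lookup F e Bool.≟ true) (incident? G v e)) (cong (_* χ (incident? G v e)) (χ-true (lookup F e)))
    two-ends : ∀ e → ∑ (allFin n) (λ v → χ (incident? G v e)) ≡ 2
    two-ends e = trans (∑-cong (allFin n) (λ v → χ-⊎ (v ≟ end₁ e) (v ≟ end₂ e) (λ { (refl , eq) → loopless e eq })))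
      (trans (∑-+ (allFin n) _ _) (cong₂ _+_ (allFin-enumerates n (end₁ e)) (allFin-enumerates n (end₂ e))))

  module Count (ℓ : ℕ) (ω : Fin m → ℤ) (w : ℤ) where
    Triple : Set
    Triple = (Subset m × Cut G) × Subset n

    InTriple : Triple → Set
    InTriple ((F , L) , c) = InC G ℓ ω w (F , L) × Within c F

    inTriple? : Decidable InTriple
    inTriple? ((F , L) , c) = InC? G ℓ ω w (F , L) ×-dec (c ⊆? (λ v → deg G F v ℕ.≟ 2))

    pairsC : List (Subset m × Cut G)
    pairsC = cartesianProduct (subsets m) (subsets n)

    triples : List Triple
    triples = cartesianProduct pairsC (subsets n)

    count-triples : count inTriple? triples ≡ 2 ^ ℓ * #C G ℓ ω w
    count-triples = begin
        count inTriple? triples                                      ≡⟨ count-as-∑ inTriple? triples ⟩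
        ∑ triples (λ x → χ (inTriple? x))                            ≡⟨ ∑-cartesian pairsC (subsets n) _ ⟩
        ∑ pairsC (λ FL → ∑ (subsets n) (λ c → χ (inTriple? (FL , c)))) ≡⟨ ∑-cong pairsC choices ⟩
        ∑ pairsC (λ FL → χ (InC? G ℓ ω w FL) * 2 ^ ℓ)                ≡⟨ ∑-*ʳ pairsC (2 ^ ℓ) _ ⟩
        ∑ pairsC (λ FL → χ (InC? G ℓ ω w FL)) * 2 ^ ℓ                ≡⟨ cong (_* 2 ^ ℓ) (count-as-∑ (InC? G ℓ ω w) pairsC) ⟨
        #C G ℓ ω w * 2 ^ ℓ                                          ≡⟨ ℕP.*-comm _ (2 ^ ℓ) ⟩
        2 ^ ℓ * #C G ℓ ω w                                          ∎
      where
      open ≡-Reasoning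
      -- for (F , L) ∈ 𝒞_w the choices c are the 2^ℓ subsets of the ℓ vertices of degree 2
      choices : ∀ FL → ∑ (subsets n) (λ c → χ (inTriple? (FL , c))) ≡ χ (InC? G ℓ ω w FL) * 2 ^ ℓ
      choices (F , L) =
        trans (∑-cong (subsets n) (λ c → χ-× (InC? G ℓ ω w (F , L)) (c ⊆? (λ v → deg G F v ℕ.≟ 2))))
          (trans (∑-*ˡ (subsets n) (χ (InC? G ℓ ω w (F , L))) (λ c → χ (c ⊆? (λ v → deg G F v ℕ.≟ 2)))) (by-membership (InC? G ℓ ω w (F , L))))
        where
        by-membership : (d : Dec (InC G ℓ ω w (F , L))) →
          χ d * ∑ (subsets n) (λ c → χ (c ⊆? (λ v → deg G F v ℕ.≟ 2))) ≡ χ d * 2 ^ ℓ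
        by-membership (yes (cover , size≡ℓ , _)) = cong (1 *_)
          (trans (count-subsets-within n (λ v → deg G F v ℕ.≟ 2)) (cong (2 ^_) (trans (handshake F cover) size≡ℓ)))
        by-membership (no _) = refl

    toTriple : Sub' G × Cut G → Triple
    toTriple (M , L) = (π G M , L) , toChoice M

    fromTriple : Triple → Sub' G × Cut G
    fromTriple ((F , L) , c) = toMatching F c , L

    toTriple-in : ∀ x → InM G ℓ ω w x → InTriple (toTriple x)
    toTriple-in (M , L) ((simple , perfect) , weight≡w , size≡ℓ , consistent) =
      ( cover
      , trans (sym (size₁-singles {M} {π G M} singles)) size≡ℓ
      , trans (sym (weight'-singles ω {M} {π G M} singles)) weight≡w
      , consistent )
      , within
      where
      open FromMatching M simple perfect
      within : Within (toChoice M) (π G M)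
      within v chosen-v with atFirst-true _ (trans (sym (VP.lookup∘tabulate _ v)) chosen-v)
      ... | e , at-e = degree-two v e at-e

    fromTriple-in : ∀ y → InTriple y → InM G ℓ ω w (fromTriple y)
    fromTriple-in ((F , L) , c) ((cover , size≡ℓ , weight≡w , consistent) , c-within) =
      ( (simple , perfect)
      , trans (weight'-singles ω {M} {F} singles) weight≡w
      , trans (size₁-singles {M} {F} singles) size≡ℓ
      , subst (Consistent G L) (sym π-M) consistent )
      where open FromCover F c cover c-within

    from-to : ∀ x → InM G ℓ ω w x → fromTriple (toTriple x) ≡ x
    from-to (M , L) ((simple , perfect) , _) = cong (_, L) (FromMatching.roundtrip M simple perfect)

    to-from : ∀ y → InTriple y → toTriple (fromTriple y) ≡ y
    to-from ((F , L) , c) ((cover , _) , c-within) = cong₂ _,_ (cong (_, L) π-M) choice-M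
      where open FromCover F c cover c-within

    matchings≡triples : #M G ℓ ω w ≡ count inTriple? triples
    matchings≡triples = count-bijection _≟ᴹ_ _≟ᵀ_ {cartesianProduct (allSub' G) (subsets n)} {triples} enumᴹ enumᵀ (InM? G ℓ ω w) inTriple?
                          toTriple fromTriple toTriple-in fromTriple-in from-to to-from
      where
      _≟ˢ_ : ∀ {k} → DecidableEquality (Subset k)
      _≟ˢ_ = VP.≡-dec Bool._≟_
      _≟ᴹ_ : DecidableEquality (Sub' G × Cut G)
      _≟ᴹ_ = PP.≡-dec (PP.≡-dec _≟ˢ_ (VP.≡-dec (VP.≡-dec _≟ˢ_))) _≟ˢ_
      _≟ᵀ_ : DecidableEquality Triple
      _≟ᵀ_ = PP.≡-dec (PP.≡-dec _≟ˢ_ _≟ˢ_) _≟ˢ_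
      enumᴹ : Enumerates _≟ᴹ_ (cartesianProduct (allSub' G) (subsets n))
      enumᴹ = cartesian-enumerates _ _ (allSub' G) (subsets n)
        (cartesian-enumerates _ _ (subsets n) blocks (subsets-enumerate n)
          (vecsOver-enumerates _ (vecsOver (subsets 2) 2) (vecsOver-enumerates _ (subsets 2) (subsets-enumerate 2) 2) m))
        (subsets-enumerate n)
        where blocks = vecsOver (vecsOver (subsets 2) 2) m
      enumᵀ : Enumerates _≟ᵀ_ triples
      enumᵀ = cartesian-enumerates _ _ pairsC (subsets n)
        (cartesian-enumerates _ _ (subsets m) (subsets n) (subsets-enumerate m) (subsets-enumerate n))
        (subsets-enumerate n)

corollary1 : (G : Graph) (ℓ : ℕ) (ω : Fin (Graph.m G) → ℤ) (w : ℤ) →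
    #M G ℓ ω w ≡ 2 ^ ℓ * #C G ℓ ω w
corollary1 G ℓ ω w = trans matchings≡triples count-triples
  where open Reduction.Count G ℓ ω w
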